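{- Let $X$ be a finite set of truth values, $\mathbf{2}=\{0,1\}$, let $\mathcal{L}_P$ be a many-valued predicate language with many-valued Herbrand valuation $v$, and let $\mathcal{M}_v$ be the corresponding Kripke model with set of worlds $\mathcal{W}=X\cup\mathbf{2}$, all as described in the context. Then for every many-valued formula $\phi\in\mathcal{L}_P$, every assignment $g$ and every $x\in X$, $$v(\phi/g)=x\iff\mathfrak{F}(v)([x]\phi/g)=1\iff\|[x]\phi/g\|=\mathcal{W}.$$
   Context: $\mathcal{L}_P$ is built from: - predicate symbols $P$; - function symbols $F$; - constants $S$; - variables $Var$; - connectives $\Sigma$ interpreted as functions $X^n\to X$. $H$ is the set of ground atoms, $\mathcal{L}$ the set of ground formulae, and $\phi/g$ denotes the ground instance of $\phi$ under an assignment $g:Var\to S$. A many-valued valuation $v:H\to X$ extends homomorphically to $\mathcal{L}$. $\mathcal{L}_M$ is the smallest set such that: $0,1\in\mathcal{L}_M$; $[x]\phi\in\mathcal{L}_M$ for $x\in X$ and $\phi\in\mathcal{L}$; $[x]\Phi\in\mathcal{L}_M$ for $x\in\mathbf{2}$ and $\Phi\in\mathcal{L}_M$; and $\mathcal{L}_M$ is closed under $\wedge$ and $\vee$. $\mathfrak{F}(v):\mathcal{L}_M\to\mathbf{2}$ is given by: - $0\mapsto0$ and $1\mapsto1$; - $[x]\phi\mapsto1$ iff $v(\phi)=x$; - $[x]\Phi\mapsto1$ iff $\mathfrak{F}(v)(\Phi)=x$; - $\mathfrak{F}(v)$ is homomorphic for $\wedge$ and $\vee$. The Kripke model $\mathcal{M}_v$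 has: - worlds $\mathcal{W}=X\cup\mathbf{2}$; - accessibility relations $\mathcal{R}_w=\mathcal{W}\times\{w\}$ for each $w\in\mathcal{W}$; - valuation $V(w,p)(c_1,\dots,c_n)=1$ iff $v(p(c_1,\dots,c_n))=w$. Satisfaction is defined by: - $\mathcal{M}_v\models_{g,w}\phi$ iff $v(\phi/g)=w$, for $\phi\in\mathcal{L}_P$; - $1$ holds everywhere and $0$ nowhere; - $\mathcal{M}_v\models_{g,w}[x]\Phi$ iff $\mathcal{M}_v\models_{g,y}\Phi$ for all $y$ with $(w,y)\in\mathcal{R}_x$; - $\wedge$ and $\vee$ are classical. $\|\Psi/g\|$ is the set of worlds where $\Psi/g$ is satisfied. -}

module Defs where

open import Data.Nat using (ℕ)
open import Data.Fin using (Fin)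
import Data.Bool
import Data.Empty
import Data.Unit
open import Data.Bool using (Bool; true; false; _∧_; _∨_)
open import Data.Sum using (_⊎_; inj₁; inj₂)
open import Data.Product using (_×_; Σ; _,_)
open import Relation.Binary.PropositionalEquality using (_≡_)
open import Relation.Binary.Definitions using (DecidableEquality)
open import Relation.Nullary.Decidable using (⌊_⌋)
open import Function.Bundles using (_⤖_)

-- A finite set of truth values X (decidable equality, in bijection
-- with some Fin n), and 𝟐 = Bool (false = 0, true = 1).

record TruthValues : Set₁ where
  field
    X      : Set
    _≟X_   : DecidableEquality X
    size   : ℕ
    finite : X ⤖ Fin size

record Language (X : Set) : Set₁ where
  field
    P    : Set
    arP  : P → ℕ
    F    : Set
    arF  : F → ℕ
    S    : Set
    Var  : Set
    Conn : Set
    arC  : Conn → ℕ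
    ⟦_⟧C : (c : Conn) → (Fin (arC c) → X) → X

module _ {X : Set} (L : Language X) where
  open Language L

  data Term : Set where
    var   : Var → Term
    const : S → Term
    app   : (f : F) → (Fin (arF f) → Term) → Term

  data GTerm : Set where
    const : S → GTerm
    app   : (f : F) → (Fin (arF f) → GTerm) → GTerm

  data Formula : Set where
    atom : (p : P) → (Fin (arP p) → Term) → Formula
    conn : (c : Conn) → (Fin (arC c) → Formula) → Formula

  GAtom : Set
  GAtom = Σ P (λ p → Fin (arP p) → GTerm)

  data GFormula : Set where
    atom : (p : P) → (Fin (arP p) → GTerm) → GFormula
    conn : (c : Conn) → (Fin (arC c) → GFormula) → GFormula

  Assignment : Set
  Assignment = Var → S

  _/ₜ_ : Term → Assignment → GTerm
  var x   /ₜ g = const (g x)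
  const c /ₜ g = const c
  app f ts /ₜ g = app f (λ i → ts i /ₜ g)

  _/_ : Formula → Assignment → GFormula
  atom p ts / g = atom p (λ i → ts i /ₜ g)
  conn c φs / g = conn c (λ i → φs i / g)

  Valuation : Set
  Valuation = GAtom → X

  ext : Valuation → GFormula → X
  ext v (atom p ts) = v (p , ts)
  ext v (conn c φs) = ⟦ c ⟧C (λ i → ext v (φs i))

-- Modal formulae over a base type A of many-valued formulae.
-- 𝓛_M = ModalF X GFormula.

data ModalF (X A : Set) : Set where
  𝟎 𝟏    : ModalF X A
  [_]ᵥ_  : X → A → ModalF X A
  [_]₂_  : Bool → ModalF X A → ModalF X A
  _∧ₘ_   : ModalF X A → ModalF X A → ModalF X A
  _∨ₘ_   : ModalF X A → ModalF X A → ModalF X A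

-- ground instance of a modal formula: Ψ/g
mapM : ∀ {X A B : Set} → (A → B) → ModalF X A → ModalF X B
mapM h 𝟎 = 𝟎
mapM h 𝟏 = 𝟏
mapM h ([ x ]ᵥ φ) = [ x ]ᵥ h φ
mapM h ([ b ]₂ Φ) = [ b ]₂ mapM h Φ
mapM h (Φ ∧ₘ Ψ) = mapM h Φ ∧ₘ mapM h Ψ
mapM h (Φ ∨ₘ Ψ) = mapM h Φ ∨ₘ mapM h Ψ

module _ (TV : TruthValues) (L : Language (TruthValues.X TV)) where
  open TruthValues TV

  𝔉 : Valuation L → ModalF X (GFormula L) → Bool
  𝔉 v 𝟎 = false
  𝔉 v 𝟏 = true
  𝔉 v ([ x ]ᵥ φ) = ⌊ ext L v φ ≟X x ⌋
  𝔉 v ([ b ]₂ Φ) = ⌊ 𝔉 v Φ Data.Bool.≟ b ⌋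
  𝔉 v (Φ ∧ₘ Ψ) = 𝔉 v Φ ∧ 𝔉 v Ψ
  𝔉 v (Φ ∨ₘ Ψ) = 𝔉 v Φ ∨ 𝔉 v Ψ

  World : Set
  World = X ⊎ Bool

  -- accessibility 𝓡_w = 𝓦 × {w}
  R : World → World → World → Set
  R w u y = y ≡ w

  V : Valuation L → World → (p : Language.P L) →
      (Fin (Language.arP L p) → GTerm L) → Set
  V v w p cs = inj₁ (v (p , cs)) ≡ w

  Sat : Valuation L → Assignment L → World → ModalF X (Formula L) → Set
  Sat v g w 𝟎 = Data.Empty.⊥
  Sat v g w 𝟏 = Data.Unit.⊤
  Sat v g w ([ x ]ᵥ φ) = ∀ y → R (inj₁ x) w y → inj₁ (ext L v (_/_ L φ g)) ≡ y
  Sat v g w ([ b ]₂ Φ) = ∀ y → R (inj₂ b) w y → Sat v g y Φ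
  Sat v g w (Φ ∧ₘ Ψ) = Sat v g w Φ × Sat v g w Ψ
  Sat v g w (Φ ∨ₘ Ψ) = Sat v g w Φ ⊎ Sat v g w Ψ

  ValidEverywhere : Valuation L → Assignment L → ModalF X (Formula L) → Set
  ValidEverywhere v g Ψ = ∀ (w : World) → Sat v g w Ψ

module Submission where

open import Defs
open import Data.Bool using (true)
open import Relation.Binary.PropositionalEquality using (_≡_)
open import Function.Bundles using (_⇔_)
open import Data.Product using (_×_)

open import Data.Bool.Properties using (T-≡)
open import Data.Product using (_,_)
open import Data.Sum using (inj₁)
open import Data.Sum.Properties using (inj₁-injective)
open import Function.Bundles using (mk⇔)
import Function.Properties.Equivalence as ⇔
open import Relation.Binary.PropositionalEquality using (refl; cong)
open import Relation.Nullary using (Dec)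
open import Relation.Nullary.Decidable using (⌊_⌋; toWitness; fromWitness)

⌊⌋≡true⇔ : ∀ {a} {A : Set a} (a? : Dec A) → ⌊ a? ⌋ ≡ true ⇔ A
⌊⌋≡true⇔ a? = ⇔.trans (⇔.sym T-≡) (mk⇔ toWitness fromWitness)

module _ (TV : TruthValues) (L : Language (TruthValues.X TV)) (v : Valuation L) where
  open TruthValues TV

  𝔉-[]ᵥ≡true⇔ : (φ : GFormula L) (x : X) →
    𝔉 TV L v ([ x ]ᵥ φ) ≡ true ⇔ ext L v φ ≡ x
  𝔉-[]ᵥ≡true⇔ φ x = ⌊⌋≡true⇔ (ext L v φ ≟X x)

  -- Every world sees exactly the world x through 𝓡ₓ, so [x]φ holds
  -- everywhere as soon as it holds anywhere.
  validEverywhere-[]ᵥ⇔ : (g : Assignment L) (φ : Formula L) (x : X) →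
    ValidEverywhere TV L v g ([ x ]ᵥ φ) ⇔ ext L v (_/_ L φ g) ≡ x
  validEverywhere-[]ᵥ⇔ g φ x = mk⇔ valued valid
    where
    valued : ValidEverywhere TV L v g ([ x ]ᵥ φ) → ext L v (_/_ L φ g) ≡ x
    valued h = inj₁-injective (h (inj₁ x) (inj₁ x) refl)

    valid : ext L v (_/_ L φ g) ≡ x → ValidEverywhere TV L v g ([ x ]ᵥ φ)
    valid eq w .(inj₁ x) refl = cong inj₁ eq

mainTheorem8 : (TV : TruthValues) (L : Language (TruthValues.X TV))
    (v : Valuation L) (φ : Formula L) (g : Assignment L) (x : TruthValues.X TV) →
    (ext L v (_/_ L φ g) ≡ x ⇔ 𝔉 TV L v ([ x ]ᵥ (_/_ L φ g)) ≡ true)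
    × (𝔉 TV L v ([ x ]ᵥ (_/_ L φ g)) ≡ true ⇔ ValidEverywhere TV L v g ([ x ]ᵥ φ))
mainTheorem8 TV L v φ g x =
  ⇔.sym 𝔉⇔ , ⇔.trans 𝔉⇔ (⇔.sym (validEverywhere-[]ᵥ⇔ TV L v g φ x))
  where
  𝔉⇔ : 𝔉 TV L v ([ x ]ᵥ (_/_ L φ g)) ≡ true ⇔ ext L v (_/_ L φ g) ≡ x
  𝔉⇔ = 𝔉-[]ᵥ≡true⇔ TV L v (_/_ L φ g) x
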